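{- Let $n\ge d$. The flip graph of a linkage $(n,d)$-matching field has exactly $\binom{n}{d+1}\cdot d$ edges.
   Context: $L=\{\ell_1,\dots,\ell_n\}$, $R=\{r_1,\dots,r_d\}$; graphs are identified with edge sets. An $(n,d)$-matching field $\mathcal M=(M_\sigma)$ assigns to each $d$-subset $\sigma\subseteq L$ a perfect matching on $\sigma\sqcup R$. It is linkage if for every $(d+1)$-subset $\tau\subseteq L$ the union of the $M_\sigma$ with $\sigma\subset\tau$ is a tree on $\tau\sqcup R$. The flip graph has the matchings of $\mathcal M$ as vertices, with two matchings adjacent iff they differ in exactly one edge. -}

module Defs where

open import Data.Nat using (ℕ; zero; suc; _≤_; _≟_)
open import Data.Fin using (Fin)
import Data.Fin as F
open import Data.Fin.Subset using (Subset; inside; outside; _∈_; _⊆_; ∣_∣)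
open import Data.Vec using ([]; _∷_)
open import Data.List using (List; []; _∷_; [_]; _++_; map; filter; length; allFin; _∷ʳ_)
open import Data.List.Relation.Unary.Unique.Propositional using (Unique)
open import Data.List.Relation.Unary.Linked using (Linked)
open import Data.List.Relation.Unary.All using (All)
open import Data.Product using (Σ; ∃; _×_; _,_)
open import Data.Sum using (_⊎_; inj₁; inj₂)
open import Relation.Nullary using (¬_; ¬?)
open import Relation.Unary using (Decidable)
open import Relation.Binary.PropositionalEquality using (_≡_; _≢_)
open import Relation.Binary.PropositionalEquality.Properties using ()

-- Vertices: L = Fin n (left), R = Fin d (right).  A bipartite graph
-- between L and R is given by its edge relation E ℓ r.

Vertex : ℕ → ℕ → Set
Vertex n d = Fin n ⊎ Fin d

data Adj {n d : ℕ} (E : Fin n → Fin d → Set) : Vertex n d → Vertex n d → Set where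
  lr : ∀ {ℓ r} → E ℓ r → Adj E (inj₁ ℓ) (inj₂ r)
  rl : ∀ {ℓ r} → E ℓ r → Adj E (inj₂ r) (inj₁ ℓ)

data Walk {n d : ℕ} (E : Fin n → Fin d → Set) : Vertex n d → Vertex n d → Set where
  here  : ∀ {u} → Walk E u u
  step  : ∀ {u w v} → Adj E u w → Walk E w v → Walk E u v

IsCycle : {n d : ℕ} → (Fin n → Fin d → Set) → List (Vertex n d) → Set
IsCycle E [] = Data.Empty.⊥ where import Data.Empty
IsCycle E (v ∷ ws) = Unique (v ∷ ws) × (2 ≤ length ws) × Linked (Adj E) ((v ∷ ws) ∷ʳ v)

IsTree : {n d : ℕ} → (Vertex n d → Set) → (Fin n → Fin d → Set) → Set
IsTree {n} {d} V E =
  ((u v : Vertex n d) → V u → V v → Walk E u v)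
  × ((c : List (Vertex n d)) → All V c → ¬ IsCycle E c)

-- Perfect matchings on σ ⊔ R.  A perfect matching is recorded by the map
-- sending each r ∈ R to its partner in σ; its edge set is {(m r , r)}.

MatchEdge : {n d : ℕ} → (Fin d → Fin n) → Fin n → Fin d → Set
MatchEdge m ℓ r = m r ≡ ℓ

IsPerfectMatching : {n d : ℕ} → Subset n → (Fin d → Fin n) → Set
IsPerfectMatching {n} {d} σ m =
  ((r : Fin d) → m r ∈ σ)
  × ((r r' : Fin d) → m r ≡ m r' → r ≡ r')
  × ((ℓ : Fin n) → ℓ ∈ σ → ∃ λ r → m r ≡ ℓ)

-- An (n,d)-matching field: for every d-subset σ of L a perfect matching on
-- σ ⊔ R.  (Values at subsets of size ≠ d are irrelevant.)
record MatchingField (n d : ℕ) : Set where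
  field
    match   : Subset n → Fin d → Fin n
    perfect : (σ : Subset n) → ∣ σ ∣ ≡ d → IsPerfectMatching σ (match σ)
open MatchingField public

UnionEdges : {n d : ℕ} → MatchingField n d → Subset n → Fin n → Fin d → Set
UnionEdges {n} {d} M τ ℓ r =
  Σ (Subset n) λ σ → σ ⊆ τ × ∣ σ ∣ ≡ d × MatchEdge (match M σ) ℓ r

InVerts : {n d : ℕ} → Subset n → Vertex n d → Set
InVerts τ (inj₁ ℓ) = ℓ ∈ τ
InVerts τ (inj₂ r) = Data.Unit.⊤ where import Data.Unit

IsLinkage : {n d : ℕ} → MatchingField n d → Set
IsLinkage {n} {d} M =
  (τ : Subset n) → ∣ τ ∣ ≡ suc d → IsTree (InVerts τ) (UnionEdges M τ)

allSubsets : (n : ℕ) → List (Subset n)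
allSubsets zero    = [ [] ]
allSubsets (suc n) = map (outside ∷_) (allSubsets n) ++ map (inside ∷_) (allSubsets n)

dSubsets : (n d : ℕ) → List (Subset n)
dSubsets n d = filter (λ s → ∣ s ∣ ≟ d) (allSubsets n)

-- unordered pairs of distinct positions of a list
pairsOf : {A : Set} → List A → List (A × A)
pairsOf []       = []
pairsOf (x ∷ xs) = map (x ,_) xs ++ pairsOf xs

-- number of edges of M_σ that are not edges of M_σ'
-- (edge (m r , r) of M_σ is in M_σ' iff m' r ≡ m r)
numEdgesNotIn : {n d : ℕ} → (Fin d → Fin n) → (Fin d → Fin n) → ℕ
numEdgesNotIn {n} {d} m m' = length (filter (λ r → ¬? (m r F.≟ m' r)) (allFin d))

-- two matchings (each with d edges) differ in exactly one edge
FlipAdjacent : {n d : ℕ} → MatchingField n d → Subset n × Subset n → Set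
FlipAdjacent M (σ , σ') = numEdgesNotIn (match M σ) (match M σ') ≡ 1

flipAdjacent? : {n d : ℕ} (M : MatchingField n d) → Decidable (FlipAdjacent M)
flipAdjacent? M (σ , σ') = numEdgesNotIn (match M σ) (match M σ') ≟ 1

-- number of edges of the flip graph: vertices are the M_σ (σ a d-subset;
-- distinct σ give distinct matchings), edges the unordered pairs of
-- matchings differing in exactly one edge.
numFlipEdges : {n d : ℕ} → MatchingField n d → ℕ
numFlipEdges {n} {d} M = length (filter (flipAdjacent? M) (pairsOf (dSubsets n d)))

module Submission where

-- Fix a (d+1)-subset τ ⊆ L and write m z = M_{τ∖z} for z ∈ τ.  The union E of
-- these matchings is a tree, and an alternating-path argument in this tree
-- (AlternatingPath) shows that matchings along E are determined by the
-- vertices they cover (matchings-agree) and that every r ∈ R has at most two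
-- neighbours (other-neighbour).  Consequently flipping m z along an edge
-- z — r gives m (m z r) (flip), so for each r there is exactly one unordered
-- pair {x , y} ⊆ τ whose matchings differ only at r (flip-pair,
-- flip-pair-unique).  Conversely two d-subsets whose matchings differ in one
-- edge are τ∖x, τ∖y for τ their union, a (d+1)-subset (FlipShape).  Double
-- counting the flip edges by the key (σ ∪ σ′ , position of the flip)
-- (fibre-count) gives one edge over each of the (n choose d+1)·d keys.

open import Defs
open import Data.Nat using (ℕ; zero; suc; _+_; _*_; _≤_; z≤n; s≤s)
import Data.Nat as ℕ
open import Data.Nat.Properties using (+-suc; +-comm; *-identityʳ; suc-injective; m≤n⇒m≤1+n; <⇒≱)
open import Data.Nat.Combinatorics using (_C_; nCk+nC[k+1]≡[n+1]C[k+1])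
open import Data.Bool.Properties using () renaming (_≟_ to _≟ᵇ_)
open import Data.Fin using (Fin; zero; suc; join; splitAt)
open import Data.Fin.Properties using (_≟_; any?; injective⇒≤; splitAt-join)
open import Data.Fin.Subset using (Subset; inside; outside; ∣_∣; _-_; _∪_; _⊆_; Nonempty) renaming (_∈_ to _∈ₛ_)
open import Data.Fin.Subset.Properties
  using (p─q⊆p; p─⊥≡p; ⊆-antisym; ∪-comm; x∈p∪q⁻; x∈p∪q⁺; x∈p∧x≢y⇒x∈p-y;
         nonempty?; Empty-unique; ∣⊥∣≡0)
open import Data.Vec using ([]; _∷_; here; there)
open import Data.Vec.Properties using (∷-injectiveʳ) renaming (≡-dec to ≡-decᵛ)
open import Data.Vec.Functional using (updateAt)
open import Data.Vec.Functional.Properties using (updateAt-updates; updateAt-minimal)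
open import Data.List using (List; []; _∷_; [_]; _++_; _∷ʳ_; map; filter; length; lookup; allFin; cartesianProduct)
open import Data.List.Properties
  using (filter-none; filter-≐; filter-++; length-++; length-map; length-tabulate; ∷-injectiveˡ) renaming (≡-dec to ≡-decˡ)
open import Data.List.Membership.Propositional using (_∈_; _∉_)
open import Data.List.Membership.Propositional.Properties
  using (∈-lookup; ∈-filter⁻; ∈-filter⁺; ∈-map⁺; ∈-map⁻; ∈-++⁺ˡ; ∈-++⁺ʳ; ∈-++⁻; ∈-allFin;
         ∈-cartesianProduct⁻; ∈-cartesianProduct⁺)
open import Data.List.Relation.Unary.Any using (here; there)
open import Data.List.Relation.Unary.All as All using (All; []; _∷_)
open import Data.List.Relation.Unary.All.Properties.Core using (¬Any⇒All¬)
open import Data.List.Relation.Unary.AllPairs as AllPairs using ([]; _∷_)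
open import Data.List.Relation.Unary.Linked using (Linked; _∷_; [-])
open import Data.List.Relation.Unary.Unique.Propositional using (Unique)
open import Data.List.Relation.Unary.Unique.Propositional.Properties
  using (Unique[x∷xs]⇒x∉xs; allFin⁺; cartesianProduct⁺)
  renaming (map⁺ to unique-map; ++⁺ to unique-++; filter⁺ to unique-filter)
open import Data.Product using (∃; ∃₂; _×_; _,_; proj₁; proj₂)
open import Data.Product.Properties using () renaming (≡-dec to ≡-decˣ)
open import Data.Sum using (_⊎_; inj₁; inj₂)
open import Data.Sum.Properties using (inj₂-injective)
open import Data.Unit using (tt)
open import Data.Empty using (⊥)
open import Function using (_∘_; const)
open import Relation.Nullary using (¬_; ¬?; yes; no; contradiction)
open import Relation.Nullary.Decidable using (_×-dec_)
open import Relation.Unary using (Decidable; _≐_)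
open import Relation.Binary.Definitions using (DecidableEquality)
open import Relation.Binary.PropositionalEquality
  using (_≡_; _≢_; refl; sym; trans; cong; cong₂; subst; subst₂; module ≡-Reasoning)

module _ {A : Set} where

  unique-lookup-injective : ∀ {xs : List A} → Unique xs →
    ∀ i j → lookup xs i ≡ lookup xs j → i ≡ j
  unique-lookup-injective {_ ∷ _} _          zero    zero    _ = refl
  unique-lookup-injective {_ ∷ _} (x∉xs ∷ _) zero    (suc j) e = contradiction e (All.lookup x∉xs (∈-lookup j))
  unique-lookup-injective {_ ∷ _} (x∉xs ∷ _) (suc i) zero    e = contradiction (sym e) (All.lookup x∉xs (∈-lookup i))
  unique-lookup-injective {_ ∷ _} (_ ∷ u)    (suc i) (suc j) e = cong suc (unique-lookup-injective u i j e)

  unique⇒length≤ : ∀ {k} (f : A → Fin k) → (∀ {a b} → f a ≡ f b → a ≡ b) →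
    ∀ {xs : List A} → Unique xs → length xs ≤ k
  unique⇒length≤ f f-inj u = injective⇒≤ (λ e → unique-lookup-injective u _ _ (f-inj e))

  filter≡[x] : ∀ {Q : A → Set} (Q? : Decidable Q) {xs : List A} {x : A} →
    Unique xs → x ∈ xs → Q x → (∀ {y} → y ∈ xs → Q y → y ≡ x) → filter Q? xs ≡ [ x ]
  filter≡[x] Q? {z ∷ zs} (z∉zs ∷ u) x∈ Qx only with Q? z
  ... | yes Qz with only (here refl) Qz
  ...   | refl = cong (z ∷_) (filter-none Q? (All.tabulate λ y∈ Qy →
                   All.lookup z∉zs y∈ (sym (only (there y∈) Qy))))
  filter≡[x] Q? (_ ∷ u) (here refl) Qx only | no ¬Qz = contradiction Qx ¬Qz
  filter≡[x] Q? (_ ∷ u) (there x∈) Qx only | no ¬Qz = filter≡[x] Q? u x∈ Qx (λ y∈ → only (there y∈))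

  filter≡[x]⁻ : ∀ {Q : A → Set} (Q? : Decidable Q) {xs : List A} {x : A} →
    filter Q? xs ≡ [ x ] → x ∈ xs × Q x × (∀ {y} → y ∈ xs → Q y → y ≡ x)
  filter≡[x]⁻ {Q} Q? {xs} {x} eq = proj₁ x∈∧Qx , proj₂ x∈∧Qx , only
    where
    x∈∧Qx : x ∈ xs × Q x
    x∈∧Qx = ∈-filter⁻ Q? {xs = xs} (subst (x ∈_) (sym eq) (here refl))
    only : ∀ {y} → y ∈ xs → Q y → y ≡ x
    only y∈ Qy with subst (_ ∈_) eq (∈-filter⁺ Q? y∈ Qy)
    ... | here y≡x = y≡x

  length≡1⇒singleton : ∀ (xs : List A) → length xs ≡ 1 → ∃ λ x → xs ≡ [ x ]
  length≡1⇒singleton (x ∷ []) _ = x , refl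

  length-filter-split : ∀ {P R : A → Set} (P? : Decidable P) (R? : Decidable R) (xs : List A) →
    length (filter P? xs) ≡
      length (filter (λ x → P? x ×-dec R? x) xs) + length (filter (λ x → P? x ×-dec ¬? (R? x)) xs)
  length-filter-split P? R? [] = refl
  length-filter-split P? R? (x ∷ xs) with P? x | R? x
  ... | yes _ | yes _ = cong suc (length-filter-split P? R? xs)
  ... | yes _ | no  _ = trans (cong suc (length-filter-split P? R? xs)) (sym (+-suc _ _))
  ... | no  _ | yes _ = length-filter-split P? R? xs
  ... | no  _ | no  _ = length-filter-split P? R? xs

  fibre-count : ∀ {B : Set} (_≟ᴮ_ : DecidableEquality B) (g : A → B) {P : A → Set} (P? : Decidable P)
    (xs : List A) (ys : List B) (c : ℕ) → Unique ys →
    (∀ {x} → x ∈ xs → P x → g x ∈ ys) →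
    (∀ {y} → y ∈ ys → length (filter (λ x → P? x ×-dec (g x ≟ᴮ y)) xs) ≡ c) →
    length (filter P? xs) ≡ length ys * c
  fibre-count _≟ᴮ_ g P? xs [] c _ lands _ =
    cong length (filter-none P? (All.tabulate λ x∈ Px → contradiction (lands x∈ Px) λ ()))
  fibre-count _≟ᴮ_ g {P} P? xs (y ∷ ys) c (y∉ys ∷ u) lands fibres = begin
    length (filter P? xs)
      ≡⟨ length-filter-split P? (λ x → g x ≟ᴮ y) xs ⟩
    length (filter (λ x → P? x ×-dec (g x ≟ᴮ y)) xs) + length (filter P-off-y? xs)
      ≡⟨ cong₂ _+_ (fibres (here refl)) (fibre-count _≟ᴮ_ g P-off-y? xs ys c u lands′ fibres′) ⟩
    c + length ys * c ∎
    where
    open ≡-Reasoning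
    P-off-y? : Decidable (λ x → P x × g x ≢ y)
    P-off-y? = λ x → P? x ×-dec ¬? (g x ≟ᴮ y)
    lands′ : ∀ {x} → x ∈ xs → P x × g x ≢ y → g x ∈ ys
    lands′ x∈ (Px , gx≢y) with lands x∈ Px
    ... | here gx≡y = contradiction gx≡y gx≢y
    ... | there gx∈ = gx∈
    fibres′ : ∀ {y′} → y′ ∈ ys →
      length (filter (λ x → P-off-y? x ×-dec (g x ≟ᴮ y′)) xs) ≡ c
    fibres′ {y′} y′∈ = trans (cong length (filter-≐ _ _ same xs)) (fibres (there y′∈))
      where
      same : (λ x → (P x × g x ≢ y) × g x ≡ y′) ≐ (λ x → P x × g x ≡ y′)
      same = (λ ((Px , _) , gx≡y′) → Px , gx≡y′)
           , (λ (Px , gx≡y′) → (Px , λ gx≡y → All.lookup y∉ys y′∈ (trans (sym gx≡y) gx≡y′)) , gx≡y′)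

  ∈-pairsOf-step : ∀ {a b x : A} xs → (a , b) ∈ pairsOf (x ∷ xs) →
    (a ≡ x × b ∈ xs) ⊎ (a , b) ∈ pairsOf xs
  ∈-pairsOf-step {x = x} xs p∈ with ∈-++⁻ (map (x ,_) xs) p∈
  ... | inj₂ p∈′ = inj₂ p∈′
  ... | inj₁ p∈′ with ∈-map⁻ (x ,_) p∈′
  ...   | _ , b∈ , refl = inj₁ (refl , b∈)

  ∈-pairsOf⁻ : ∀ {a b : A} xs → (a , b) ∈ pairsOf xs → a ∈ xs × b ∈ xs
  ∈-pairsOf⁻ (x ∷ xs) p∈ with ∈-pairsOf-step xs p∈
  ... | inj₁ (refl , b∈) = here refl , there b∈
  ... | inj₂ p∈′ with ∈-pairsOf⁻ xs p∈′
  ...   | a∈ , b∈ = there a∈ , there b∈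

  ∈-pairsOf⁺ : ∀ {a b : A} {xs} → a ∈ xs → b ∈ xs → a ≢ b →
    (a , b) ∈ pairsOf xs ⊎ (b , a) ∈ pairsOf xs
  ∈-pairsOf⁺ (here refl) (here refl) a≢b = contradiction refl a≢b
  ∈-pairsOf⁺ (here refl) (there b∈) _ = inj₁ (∈-++⁺ˡ (∈-map⁺ _ b∈))
  ∈-pairsOf⁺ (there a∈) (here refl) _ = inj₂ (∈-++⁺ˡ (∈-map⁺ _ a∈))
  ∈-pairsOf⁺ {xs = x ∷ xs} (there a∈) (there b∈) a≢b with ∈-pairsOf⁺ a∈ b∈ a≢b
  ... | inj₁ p∈ = inj₁ (∈-++⁺ʳ (map (x ,_) xs) p∈)
  ... | inj₂ p∈ = inj₂ (∈-++⁺ʳ (map (x ,_) xs) p∈)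

  pairsOf-asymmetric : ∀ {a b : A} {xs} → Unique xs →
    (a , b) ∈ pairsOf xs → (b , a) ∈ pairsOf xs → ⊥
  pairsOf-asymmetric {xs = x ∷ xs} u@(_ ∷ u′) ab∈ ba∈
    with ∈-pairsOf-step xs ab∈ | ∈-pairsOf-step xs ba∈
  ... | inj₁ (refl , _)  | inj₁ (refl , a∈) = Unique[x∷xs]⇒x∉xs u a∈
  ... | inj₁ (refl , _)  | inj₂ ba∈′        = Unique[x∷xs]⇒x∉xs u (proj₂ (∈-pairsOf⁻ xs ba∈′))
  ... | inj₂ ab∈′        | inj₁ (refl , _)  = Unique[x∷xs]⇒x∉xs u (proj₂ (∈-pairsOf⁻ xs ab∈′))
  ... | inj₂ ab∈′        | inj₂ ba∈′        = pairsOf-asymmetric u′ ab∈′ ba∈′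

  pairsOf-unique : ∀ {xs : List A} → Unique xs → Unique (pairsOf xs)
  pairsOf-unique {[]} _ = []
  pairsOf-unique {x ∷ xs} u@(_ ∷ u′) = unique-++ (unique-map (λ { refl → refl }) u′) (pairsOf-unique u′) disjoint
    where
    disjoint : ∀ {p} → ¬ (p ∈ map (x ,_) xs × p ∈ pairsOf xs)
    disjoint (p∈ , p∈′) with ∈-map⁻ (x ,_) p∈
    ... | _ , _ , refl = Unique[x∷xs]⇒x∉xs u (proj₁ (∈-pairsOf⁻ xs p∈′))

length-cartesianProduct : ∀ {A B : Set} (xs : List A) (ys : List B) →
  length (cartesianProduct xs ys) ≡ length xs * length ys
length-cartesianProduct []       ys = refl
length-cartesianProduct (x ∷ xs) ys =
  trans (length-++ (map (x ,_) ys)) (cong₂ _+_ (length-map (x ,_) ys) (length-cartesianProduct xs ys))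

allSubsets-complete : ∀ {n} (s : Subset n) → s ∈ allSubsets n
allSubsets-complete [] = here refl
allSubsets-complete {suc n} (outside ∷ s) = ∈-++⁺ˡ (∈-map⁺ (outside ∷_) (allSubsets-complete s))
allSubsets-complete {suc n} (inside ∷ s) =
  ∈-++⁺ʳ (map (outside ∷_) (allSubsets n)) (∈-map⁺ (inside ∷_) (allSubsets-complete s))

allSubsets-unique : ∀ n → Unique (allSubsets n)
allSubsets-unique zero = [] ∷ []
allSubsets-unique (suc n) =
  unique-++ (unique-map ∷-injectiveʳ (allSubsets-unique n)) (unique-map ∷-injectiveʳ (allSubsets-unique n)) disjoint
  where
  disjoint : ∀ {s} → ¬ (s ∈ map (outside ∷_) (allSubsets n) × s ∈ map (inside ∷_) (allSubsets n))
  disjoint (s∈ , s∈′) with ∈-map⁻ (outside ∷_) s∈ | ∈-map⁻ (inside ∷_) s∈′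
  ... | _ , _ , refl | _ , _ , ()

length-filter-map : ∀ {A B : Set} {P : B → Set} (P? : Decidable P) (f : A → B) (xs : List A) →
  length (filter P? (map f xs)) ≡ length (filter (P? ∘ f) xs)
length-filter-map P? f [] = refl
length-filter-map P? f (x ∷ xs) with P? (f x)
... | yes _ = cong suc (length-filter-map P? f xs)
... | no  _ = length-filter-map P? f xs

-- There are n choose k subsets of size k (Pascal's rule, splitting on the
-- first element).
length-dSubsets : ∀ n k → length (dSubsets n k) ≡ n C k
length-dSubsets zero    zero    = refl
length-dSubsets zero    (suc k) = refl
length-dSubsets (suc n) k = begin
  length (filter size≟k (map (outside ∷_) S ++ map (inside ∷_) S))
    ≡⟨ trans (cong length (filter-++ size≟k (map (outside ∷_) S) _)) (length-++ (filter size≟k (map (outside ∷_) S))) ⟩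
  length (filter size≟k (map (outside ∷_) S)) + length (filter size≟k (map (inside ∷_) S))
    ≡⟨ cong₂ _+_ (trans (length-filter-map size≟k (outside ∷_) S) (length-dSubsets n k))
                  (length-filter-map size≟k (inside ∷_) S) ⟩
  n C k + length (filter (size≟k ∘ (inside ∷_)) S)
    ≡⟨ with-first k ⟩
  suc n C k ∎
  where
  open ≡-Reasoning
  S : List (Subset n)
  S = allSubsets n
  size≟k : Decidable (λ (s : Subset (suc n)) → ∣ s ∣ ≡ k)
  size≟k s = ∣ s ∣ ℕ.≟ k
  with-first : ∀ k → n C k + length (filter (λ s → ∣ inside ∷ s ∣ ℕ.≟ k) S) ≡ suc n C k
  with-first zero = cong (λ m → n C 0 + length m)
    (filter-none (λ s → ∣ inside ∷ s ∣ ℕ.≟ 0) {xs = S} (All.tabulate λ _ ()))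
  with-first (suc k) = begin
    n C suc k + length (filter (λ s → suc ∣ s ∣ ℕ.≟ suc k) S)
      ≡⟨ cong (λ m → n C suc k + length m) (filter-≐ _ _ (suc-injective , cong suc) S) ⟩
    n C suc k + length (filter (λ s → ∣ s ∣ ℕ.≟ k) S)
      ≡⟨ cong (n C suc k +_) (length-dSubsets n k) ⟩
    n C suc k + n C k
      ≡⟨ +-comm (n C suc k) (n C k) ⟩
    n C k + n C suc k
      ≡⟨ nCk+nC[k+1]≡[n+1]C[k+1] n k ⟩
    suc n C suc k ∎

x∈p-y⇒x∈p : ∀ {n} {p : Subset n} {x y} → x ∈ₛ p - y → x ∈ₛ p
x∈p-y⇒x∈p {p = p} = p─q⊆p p _

x∈p-y⇒x≢y : ∀ {n} {p : Subset n} {x y} → x ∈ₛ p - y → x ≢ y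
x∈p-y⇒x≢y {p = _ ∷ _} {zero}  {zero}  ()
x∈p-y⇒x≢y {p = _ ∷ _} {zero}  {suc y} _ ()
x∈p-y⇒x≢y {p = _ ∷ _} {suc x} {zero}  _ ()
x∈p-y⇒x≢y {p = _ ∷ _} {suc x} {suc y} (there x∈) refl = x∈p-y⇒x≢y x∈ refl

∣p∣≡1+∣p-x∣ : ∀ {n} {p : Subset n} {x} → x ∈ₛ p → ∣ p ∣ ≡ suc ∣ p - x ∣
∣p∣≡1+∣p-x∣ {p = inside ∷ p}  {zero}  here = cong suc (cong ∣_∣ (sym (p─⊥≡p p)))
∣p∣≡1+∣p-x∣ {p = inside ∷ p}  {suc x} (there x∈) = cong suc (∣p∣≡1+∣p-x∣ x∈)
∣p∣≡1+∣p-x∣ {p = outside ∷ p} {suc x} (there x∈) = ∣p∣≡1+∣p-x∣ x∈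

size≡suc⇒nonempty : ∀ {n k} {p : Subset n} → ∣ p ∣ ≡ suc k → Nonempty p
size≡suc⇒nonempty {n} {p = p} size with nonempty? p
... | yes ne = ne
... | no ¬ne = contradiction (trans (sym (∣⊥∣≡0 n)) (trans (cong ∣_∣ (sym (Empty-unique ¬ne))) size)) λ ()

p-x∪p-y≡p : ∀ {n} {p : Subset n} {x y} → x ∈ₛ p → y ∈ₛ p → x ≢ y → (p - x) ∪ (p - y) ≡ p
p-x∪p-y≡p {p = p} {x} {y} x∈p y∈p x≢y = ⊆-antisym ⊆p p⊆
  where
  ⊆p : (p - x) ∪ (p - y) ⊆ p
  ⊆p z∈ with x∈p∪q⁻ (p - x) (p - y) z∈
  ... | inj₁ z∈p-x = x∈p-y⇒x∈p z∈p-x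
  ... | inj₂ z∈p-y = x∈p-y⇒x∈p z∈p-y
  p⊆ : p ⊆ (p - x) ∪ (p - y)
  p⊆ {z} z∈p with z ≟ x
  ... | yes refl = x∈p∪q⁺ (inj₂ (x∈p∧x≢y⇒x∈p-y z∈p x≢y))
  ... | no  z≢x  = x∈p∪q⁺ (inj₁ (x∈p∧x≢y⇒x∈p-y z∈p z≢x))

vertices-length≤ : ∀ {n d} {vs : List (Vertex n d)} → Unique vs → length vs ≤ n + d
vertices-length≤ {n} {d} = unique⇒length≤ (join n d) join-injective
  where
  join-injective : ∀ {u v} → join n d u ≡ join n d v → u ≡ v
  join-injective {u} {v} e = trans (sym (splitAt-join n d u)) (trans (cong (splitAt n) e) (splitAt-join n d v))

-- Let p, q : R → L record edges (p j , j), (q j , j) of E, with q injective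
-- into τ, and let s ∈ τ be a neighbour of r₀ hit by q at most at r₀.  Start at
-- r₀, step to s, and repeatedly go back along p and forward along q:
--   r₀ — s = p j₁ — j₁ — q j₁ = p j₂ — j₂ — q j₂ — ⋯
-- Acyclicity keeps this path simple, so it must stop at a left vertex x that
-- p hits at most at r₀.  If every such "exit" vertex is a neighbour of r₀, the
-- path closes into a cycle; hence under that hypothesis the walk cannot even
-- begin: p hits s at most at r₀.
module AlternatingPath {n d : ℕ} (E : Fin n → Fin d → Set) (τ : Subset n)
  (acyclic : (c : List (Vertex n d)) → All (InVerts τ) c → ¬ IsCycle E c)
  (r₀ : Fin d) (p q : Fin d → Fin n)
  (p-edge : ∀ j → E (p j) j) (q-edge : ∀ j → E (q j) j)
  (q-injective : ∀ {i j} → q i ≡ q j → i ≡ j) (q-in-τ : ∀ j → q j ∈ₛ τ)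
  (s : Fin n) (s∈τ : s ∈ₛ τ) (s-edge : E s r₀) (q-avoids-s : ∀ j → j ≢ r₀ → q j ≢ s)
  (exit : ∀ e → e ∈ₛ τ → (e ≡ s ⊎ ∃ λ j → q j ≡ e) → (∀ j → j ≢ r₀ → p j ≢ e) → E e r₀)
  where

  -- A trail is the path x ∷ rest, ending at s, read from its newest left
  -- vertex x; it keeps track of why it is simple and why it can be continued.
  record Trail (x : Fin n) (rest : List (Vertex n d)) : Set where
    field
      distinct   : Unique (inj₂ r₀ ∷ inj₁ x ∷ rest)
      path       : Linked (Adj E) ((inj₁ x ∷ rest) ∷ʳ inj₂ r₀)
      within     : All (InVerts τ) (inj₁ x ∷ rest)
      p-inside   : ∀ {j} → inj₂ j ∈ inj₁ x ∷ rest → inj₁ (p j) ∈ inj₁ x ∷ rest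
      p-misses   : ∀ {j} → inj₂ j ∈ inj₁ x ∷ rest → p j ≢ x
      q-explains : ∀ {ℓ} → inj₁ ℓ ∈ inj₁ x ∷ rest →
        ℓ ≡ s ⊎ ∃ λ j → inj₂ j ∈ inj₁ x ∷ rest × q j ≡ ℓ

  open Trail

  trivial : Trail s []
  trivial = record
    { distinct   = ((λ ()) ∷ []) ∷ [] ∷ []
    ; path       = lr s-edge ∷ [-]
    ; within     = s∈τ ∷ []
    ; p-inside   = λ { (here ()) ; (there ()) }
    ; p-misses   = λ { (here ()) ; (there ()) }
    ; q-explains = λ { (here refl) → inj₁ refl ; (there ()) }
    }

  extend : ∀ {x rest} → Trail x rest → ∀ j → j ≢ r₀ → p j ≡ x → Trail (q j) (inj₂ j ∷ inj₁ x ∷ rest)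
  extend {x} {rest} T j j≢r₀ pj≡x = record
    { distinct   = ((λ ()) ∷ (λ r₀≡j → j≢r₀ (sym (inj₂-injective r₀≡j))) ∷ r₀∉Q)
                   ∷ ((λ ()) ∷ ¬Any⇒All¬ Q qj∉Q)
                   ∷ ¬Any⇒All¬ Q j∉Q
                   ∷ Q-distinct
    ; path       = lr (q-edge j) ∷ rl (subst (λ ℓ → E ℓ j) pj≡x (p-edge j)) ∷ path T
    ; within     = q-in-τ j ∷ tt ∷ within T
    ; p-inside   = λ j′∈ → there (there (p-into-Q j′∈))
    ; p-misses   = λ j′∈ pj′≡qj → qj∉Q (subst (λ ℓ → inj₁ ℓ ∈ Q) pj′≡qj (p-into-Q j′∈))
    ; q-explains = q-explains′
    }
    where
    Q : List (Vertex n d)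
    Q = inj₁ x ∷ rest
    r₀∉Q : All (inj₂ r₀ ≢_) Q
    r₀∉Q = AllPairs.head (distinct T)
    Q-distinct : Unique Q
    Q-distinct = AllPairs.tail (distinct T)
    j∉Q : inj₂ j ∉ Q
    j∉Q j∈ = p-misses T j∈ pj≡x
    qj∉Q : inj₁ (q j) ∉ Q
    qj∉Q qj∈ with q-explains T qj∈
    ... | inj₁ qj≡s = q-avoids-s j j≢r₀ qj≡s
    ... | inj₂ (j′ , j′∈ , qj′≡qj) = j∉Q (subst (λ i → inj₂ i ∈ Q) (q-injective qj′≡qj) j′∈)
    p-into-Q : ∀ {j′} → inj₂ j′ ∈ inj₁ (q j) ∷ inj₂ j ∷ Q → inj₁ (p j′) ∈ Q
    p-into-Q (here ())
    p-into-Q (there (here refl)) = here (cong inj₁ pj≡x)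
    p-into-Q (there (there j′∈)) = p-inside T j′∈
    q-explains′ : ∀ {ℓ} → inj₁ ℓ ∈ inj₁ (q j) ∷ inj₂ j ∷ Q →
      ℓ ≡ s ⊎ ∃ λ j′ → inj₂ j′ ∈ inj₁ (q j) ∷ inj₂ j ∷ Q × q j′ ≡ ℓ
    q-explains′ (here refl) = inj₂ (j , there (here refl) , refl)
    q-explains′ (there (here ()))
    q-explains′ (there (there ℓ∈)) with q-explains T ℓ∈
    ... | inj₁ ℓ≡s = inj₁ ℓ≡s
    ... | inj₂ (j′ , j′∈ , qj′≡ℓ) = inj₂ (j′ , there (there j′∈) , qj′≡ℓ)

  -- If p misses the head x outside r₀, the exit edge x — r₀ closes a cycle.
  close : ∀ {x v rest} → Trail x (v ∷ rest) → (∀ j → j ≢ r₀ → p j ≢ x) → ⊥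
  close {x} {v} {rest} T misses = acyclic (inj₂ r₀ ∷ inj₁ x ∷ v ∷ rest) (tt ∷ within T)
    (distinct T , s≤s (s≤s z≤n) , rl (exit x x∈τ explained misses) ∷ path T)
    where
    x∈τ : x ∈ₛ τ
    x∈τ with within T
    ... | x∈τ ∷ _ = x∈τ
    explained : x ≡ s ⊎ ∃ λ j → q j ≡ x
    explained with q-explains T (here refl)
    ... | inj₁ x≡s = inj₁ x≡s
    ... | inj₂ (j , _ , qj≡x) = inj₂ (j , qj≡x)

  -- Once started, trails exist of every length ...
  LongTrail : ℕ → Set
  LongTrail k = ∃₂ λ x v → ∃ λ rest → Trail x (v ∷ rest) × k ≤ length rest

  long-trail : ∀ {j₁} → j₁ ≢ r₀ → p j₁ ≡ s → ∀ k → LongTrail k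
  long-trail {j₁} j₁≢r₀ pj₁≡s zero = _ , _ , _ , extend trivial j₁ j₁≢r₀ pj₁≡s , z≤n
  long-trail j₁≢r₀ pj₁≡s (suc k) with long-trail j₁≢r₀ pj₁≡s k
  ... | x , v , rest , T , k≤ with any? (λ j → ¬? (j ≟ r₀) ×-dec (p j ≟ x))
  ...   | yes (j , j≢r₀ , pj≡x) = _ , _ , _ , extend T j j≢r₀ pj≡x , s≤s (m≤n⇒m≤1+n k≤)
  ...   | no  none = contradiction (close T λ j j≢r₀ pj≡x → none (j , j≢r₀ , pj≡x)) λ ()

  -- ... which is impossible in a graph with n + d vertices.
  p-avoids-s : ∀ j → j ≢ r₀ → p j ≢ s
  p-avoids-s j j≢r₀ pj≡s with long-trail j≢r₀ pj≡s (n + d)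
  ... | _ , _ , _ , T , n+d≤ = <⇒≱ (s≤s (m≤n⇒m≤1+n (m≤n⇒m≤1+n n+d≤))) (vertices-length≤ (distinct T))

DifferOnlyAt : ∀ {n d} → (Fin d → Fin n) → (Fin d → Fin n) → Fin d → Set
DifferOnlyAt f g r = f r ≢ g r × (∀ r′ → r′ ≢ r → f r′ ≡ g r′)

DifferOnlyAt-sym : ∀ {n d} {f g : Fin d → Fin n} {r} → DifferOnlyAt f g r → DifferOnlyAt g f r
DifferOnlyAt-sym (fr≢gr , agree) = (λ gr≡fr → fr≢gr (sym gr≡fr)) , (λ r′ r′≢r → sym (agree r′ r′≢r))

module WithinTree {n d : ℕ} (M : MatchingField n d) (linkage : IsLinkage M)
  (τ : Subset n) (∣τ∣≡1+d : ∣ τ ∣ ≡ suc d) where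

  E : Fin n → Fin d → Set
  E = UnionEdges M τ

  m : Fin n → Fin d → Fin n
  m z = match M (τ - z)

  ∣τ-z∣≡d : ∀ {z} → z ∈ₛ τ → ∣ τ - z ∣ ≡ d
  ∣τ-z∣≡d z∈τ = suc-injective (trans (sym (∣p∣≡1+∣p-x∣ z∈τ)) ∣τ∣≡1+d)

  module _ {z : Fin n} (z∈τ : z ∈ₛ τ) where

    private
      m-perfect : IsPerfectMatching (τ - z) (m z)
      m-perfect = perfect M (τ - z) (∣τ-z∣≡d z∈τ)

    m-in-τ : ∀ r → m z r ∈ₛ τ
    m-in-τ r = x∈p-y⇒x∈p (proj₁ m-perfect r)

    m-avoids : ∀ r → m z r ≢ z
    m-avoids r = x∈p-y⇒x≢y (proj₁ m-perfect r)

    m-injective : ∀ {i j} → m z i ≡ m z j → i ≡ j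
    m-injective = proj₁ (proj₂ m-perfect) _ _

    m-onto : ∀ {ℓ} → ℓ ∈ₛ τ → ℓ ≢ z → ∃ λ r → m z r ≡ ℓ
    m-onto ℓ∈τ ℓ≢z = proj₂ (proj₂ m-perfect) _ (x∈p∧x≢y⇒x∈p-y ℓ∈τ ℓ≢z)

    m-edge : ∀ r → E (m z r) r
    m-edge r = τ - z , x∈p-y⇒x∈p , ∣τ-z∣≡d z∈τ , refl

  edge-in-τ : ∀ {ℓ r} → E ℓ r → ℓ ∈ₛ τ
  edge-in-τ {r = r} (σ , σ⊆τ , ∣σ∣≡d , mσr≡ℓ) =
    σ⊆τ (subst (_∈ₛ σ) mσr≡ℓ (proj₁ (perfect M σ ∣σ∣≡d) r))

  open AlternatingPath E τ (proj₂ (linkage τ ∣τ∣≡1+d)) using (p-avoids-s)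

  matchings-agree : (p q : Fin d → Fin n) → (∀ j → E (p j) j) → (∀ j → E (q j) j) →
    (∀ {i j} → q i ≡ q j → i ≡ j) → (∀ j → ∃ λ j′ → p j′ ≡ q j) → ∀ r → p r ≡ q r
  matchings-agree p q p-edge q-edge q-injective covered r with covered r
  ... | j , pj≡qr with j ≟ r
  ...   | yes refl = pj≡qr
  ...   | no  j≢r  = contradiction pj≡qr
          (p-avoids-s r p q p-edge q-edge q-injective (λ j → edge-in-τ (q-edge j))
             (q r) (edge-in-τ (q-edge r)) (q-edge r) (λ j j≢r qj≡qr → j≢r (q-injective qj≡qr)) exit j j≢r)
    where
    exit : ∀ e → e ∈ₛ τ → (e ≡ q r ⊎ ∃ λ j → q j ≡ e) → (∀ j → j ≢ r → p j ≢ e) → E e r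
    exit e _ (inj₁ e≡qr) _ = subst (λ ℓ → E ℓ r) (sym e≡qr) (q-edge r)
    exit e _ (inj₂ (j , qj≡e)) p-misses-e with covered j
    ... | j′ , pj′≡qj with j′ ≟ r
    ...   | yes refl = subst (λ ℓ → E ℓ r) (trans pj′≡qj qj≡e) (p-edge r)
    ...   | no  j′≢r = contradiction (trans pj′≡qj qj≡e) (p-misses-e j′ j′≢r)

  flip : ∀ {z r} → E z r → ∀ r′ → m (m z r) r′ ≡ updateAt (m z) r (const z) r′
  flip {z} {r} z—r = matchings-agree (m ℓ) q (m-edge ℓ∈τ) q-edge q-injective covered
    where
    z∈τ : z ∈ₛ τ
    z∈τ = edge-in-τ z—r
    ℓ : Fin n
    ℓ = m z r
    ℓ∈τ : ℓ ∈ₛ τ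
    ℓ∈τ = m-in-τ z∈τ r
    q : Fin d → Fin n
    q = updateAt (m z) r (const z)
    q-view : ∀ j → (j ≡ r × q j ≡ z) ⊎ (j ≢ r × q j ≡ m z j)
    q-view j with j ≟ r
    ... | yes refl = inj₁ (refl , updateAt-updates r (m z))
    ... | no  j≢r  = inj₂ (j≢r , updateAt-minimal j r (m z) j≢r)
    q-injective : ∀ {i j} → q i ≡ q j → i ≡ j
    q-injective {i} {j} qi≡qj with q-view i | q-view j
    ... | inj₁ (refl , _)   | inj₁ (refl , _)   = refl
    ... | inj₁ (_ , qi≡z)   | inj₂ (_ , qj≡mzj) =
          contradiction (trans (sym qj≡mzj) (trans (sym qi≡qj) qi≡z)) (m-avoids z∈τ j)
    ... | inj₂ (_ , qi≡mzi) | inj₁ (_ , qj≡z)   =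
          contradiction (trans (sym qi≡mzi) (trans qi≡qj qj≡z)) (m-avoids z∈τ i)
    ... | inj₂ (_ , qi≡mzi) | inj₂ (_ , qj≡mzj) =
          m-injective z∈τ (trans (sym qi≡mzi) (trans qi≡qj qj≡mzj))
    q-edge : ∀ j → E (q j) j
    q-edge j with q-view j
    ... | inj₁ (refl , qr≡z)  = subst (λ ℓ′ → E ℓ′ r) (sym qr≡z) z—r
    ... | inj₂ (_ , qj≡mzj)   = subst (λ ℓ′ → E ℓ′ j) (sym qj≡mzj) (m-edge z∈τ j)
    covered : ∀ j → ∃ λ j′ → m ℓ j′ ≡ q j
    covered j with q-view j
    ... | inj₁ (_ , qj≡z) with m-onto ℓ∈τ z∈τ (λ z≡ℓ → m-avoids z∈τ r (sym z≡ℓ))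
    ...   | j′ , mℓj′≡z = j′ , trans mℓj′≡z (sym qj≡z)
    covered j | inj₂ (j≢r , qj≡mzj) with m-onto ℓ∈τ (m-in-τ z∈τ j) (λ mzj≡ℓ → j≢r (m-injective z∈τ mzj≡ℓ))
    ...   | j′ , mℓj′≡mzj = j′ , trans mℓj′≡mzj (sym qj≡mzj)

  flip-at : ∀ {z r} → E z r → m (m z r) r ≡ z
  flip-at {z} {r} z—r = trans (flip z—r r) (updateAt-updates r (m z))

  flip-off : ∀ {z r} → E z r → ∀ r′ → r′ ≢ r → m (m z r) r′ ≡ m z r′
  flip-off {z} {r} z—r r′ r′≢r = trans (flip z—r r′) (updateAt-minimal r′ r (m z) r′≢r)

  -- r has at most two neighbours: any neighbour y ≠ x of r is m x r.
  other-neighbour : ∀ {x y r} → E x r → E y r → x ≢ y → m x r ≡ y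
  other-neighbour {x} {y} {r} x—r y—r x≢y
    with m-onto (edge-in-τ x—r) (edge-in-τ y—r) (λ y≡x → x≢y (sym y≡x))
  ... | j , mxj≡y with j ≟ r
  ...   | yes refl = mxj≡y
  ...   | no  j≢r  = contradiction mxj≡y
          (p-avoids-s r (m x) (m y) (m-edge x∈τ) (m-edge y∈τ) (m-injective y∈τ) (m-in-τ y∈τ)
             y y∈τ y—r (λ j _ → m-avoids y∈τ j) exit j j≢r)
    where
    x∈τ : x ∈ₛ τ
    x∈τ = edge-in-τ x—r
    y∈τ : y ∈ₛ τ
    y∈τ = edge-in-τ y—r
    exit : ∀ e → e ∈ₛ τ → (e ≡ y ⊎ ∃ λ j → m y j ≡ e) → (∀ j → j ≢ r → m x j ≢ e) → E e r
    exit e e∈τ _ p-misses-e with e ≟ x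
    ... | yes refl = x—r
    ... | no  e≢x with m-onto x∈τ e∈τ e≢x
    ...   | j′ , mxj′≡e with j′ ≟ r
    ...     | yes refl = subst (λ ℓ → E ℓ r) mxj′≡e (m-edge x∈τ r)
    ...     | no  j′≢r = contradiction mxj′≡e (p-misses-e j′ j′≢r)

  FlipPair : Fin d → Fin n → Fin n → Set
  FlipPair r x y = x ∈ₛ τ × y ∈ₛ τ × x ≢ y × DifferOnlyAt (m x) (m y) r

  FlipPair-sym : ∀ {r x y} → FlipPair r x y → FlipPair r y x
  FlipPair-sym (x∈τ , y∈τ , x≢y , diff) = y∈τ , x∈τ , (λ y≡x → x≢y (sym y≡x)) , DifferOnlyAt-sym diff

  -- Every r has a flip pair: z — r is an edge for z = m ℓ r, and flipping
  -- along it changes only the edge at r.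
  flip-pair : ∀ r → ∃₂ λ x y → FlipPair r x y
  flip-pair r with size≡suc⇒nonempty ∣τ∣≡1+d
  ... | ℓ , ℓ∈τ =
    z , m z r , z∈τ , m-in-τ z∈τ r , z≢mzr , (mzr≢mmzrr , λ r′ r′≢r → sym (flip-off z—r r′ r′≢r))
    where
    z : Fin n
    z = m ℓ r
    z—r : E z r
    z—r = m-edge ℓ∈τ r
    z∈τ : z ∈ₛ τ
    z∈τ = m-in-τ ℓ∈τ r
    z≢mzr : z ≢ m z r
    z≢mzr z≡mzr = m-avoids z∈τ r (sym z≡mzr)
    mzr≢mmzrr : m z r ≢ m (m z r) r
    mzr≢mmzrr e = m-avoids z∈τ r (trans e (flip-at z—r))

  flip-partner : ∀ {r x y} → FlipPair r x y → m x r ≡ y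
  flip-partner {r} (x∈τ , y∈τ , x≢y , (_ , agree)) with m-onto x∈τ y∈τ (λ y≡x → x≢y (sym y≡x))
  ... | j , mxj≡y with j ≟ r
  ...   | yes refl = mxj≡y
  ...   | no  j≢r  = contradiction (trans (sym (agree j j≢r)) mxj≡y) (m-avoids y∈τ j)

  flip-edge : ∀ {r x y} → FlipPair r x y → E y r
  flip-edge pair@(x∈τ , _) = subst (λ ℓ → E ℓ _) (flip-partner pair) (m-edge x∈τ _)

  -- The flip pair at r is unique up to order, since r has only two neighbours.
  flip-pair-unique : ∀ {r a b a′ b′} → FlipPair r a b → FlipPair r a′ b′ →
    (a ≡ a′ × b ≡ b′) ⊎ (a ≡ b′ × b ≡ a′)
  flip-pair-unique {r} {a} {a′ = a′} {b′} ab a′b′ with a ≟ a′ | a ≟ b′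
  ... | yes refl | _        = inj₁ (refl , trans (sym (flip-partner ab)) (flip-partner a′b′))
  ... | no  _    | yes refl = inj₂ (refl , trans (sym (flip-partner ab)) (flip-partner (FlipPair-sym a′b′)))
  ... | no  a≢a′ | no  a≢b′ = contradiction
        (trans (sym (other-neighbour a—r (flip-edge (FlipPair-sym a′b′)) a≢a′))
               (other-neighbour a—r (flip-edge a′b′) a≢b′))
        (proj₁ (proj₂ (proj₂ a′b′)))
    where
    a—r : E a r
    a—r = flip-edge (FlipPair-sym ab)

-- Two d-subsets σ, σ′ whose matchings differ exactly at r: the vertex
-- a = M_σ r lies in σ but not in σ′, and σ′ = (σ ∪ σ′) ∖ a; so σ ∪ σ′ has
-- d + 1 elements.
module FlipShape {n d : ℕ} (M : MatchingField n d) {σ σ′ : Subset n}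
  (∣σ∣≡d : ∣ σ ∣ ≡ d) (∣σ′∣≡d : ∣ σ′ ∣ ≡ d) {r : Fin d}
  (diff : DifferOnlyAt (match M σ) (match M σ′) r) where

  private
    Mσ-perfect : IsPerfectMatching σ (match M σ)
    Mσ-perfect = perfect M σ ∣σ∣≡d
    Mσ′-perfect : IsPerfectMatching σ′ (match M σ′)
    Mσ′-perfect = perfect M σ′ ∣σ′∣≡d
    mσr≢mσ′r : match M σ r ≢ match M σ′ r
    mσr≢mσ′r = proj₁ diff
    agree : ∀ r′ → r′ ≢ r → match M σ r′ ≡ match M σ′ r′
    agree = proj₂ diff

  a : Fin n
  a = match M σ r

  a∈σ : a ∈ₛ σ
  a∈σ = proj₁ Mσ-perfect r

  -- Whatever M_σ′ matches to a must be r, which it is not.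
  a∉σ′ : ¬ (a ∈ₛ σ′)
  a∉σ′ a∈σ′ with proj₂ (proj₂ Mσ′-perfect) a a∈σ′
  ... | j , mσ′j≡a with j ≟ r
  ...   | yes refl = mσr≢mσ′r (sym mσ′j≡a)
  ...   | no  j≢r  = j≢r (proj₁ (proj₂ Mσ-perfect) j r (trans (agree j j≢r) mσ′j≡a))

  -- Every other vertex of σ is matched by M_σ at some j ≠ r, hence lies in σ′.
  σ-a⊆σ′ : ∀ {x} → x ∈ₛ σ → x ≢ a → x ∈ₛ σ′
  σ-a⊆σ′ x∈σ x≢a with proj₂ (proj₂ Mσ-perfect) _ x∈σ
  ... | j , mσj≡x with j ≟ r
  ...   | yes refl = contradiction (sym mσj≡x) x≢a
  ...   | no  j≢r  = subst (_∈ₛ σ′) (trans (sym (agree j j≢r)) mσj≡x) (proj₁ Mσ′-perfect j)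

  σ′≡σ∪σ′-a : σ′ ≡ (σ ∪ σ′) - a
  σ′≡σ∪σ′-a = ⊆-antisym
    (λ x∈σ′ → x∈p∧x≢y⇒x∈p-y (x∈p∪q⁺ (inj₂ x∈σ′)) λ { refl → a∉σ′ x∈σ′ })
    (λ x∈ → case-union (x∈p-y⇒x∈p x∈) (x∈p-y⇒x≢y x∈))
    where
    case-union : ∀ {x} → x ∈ₛ σ ∪ σ′ → x ≢ a → x ∈ₛ σ′
    case-union {x} x∈∪ x≢a with x∈p∪q⁻ σ σ′ x∈∪
    ... | inj₁ x∈σ  = σ-a⊆σ′ x∈σ x≢a
    ... | inj₂ x∈σ′ = x∈σ′

  ∣σ∪σ′∣≡1+d : ∣ σ ∪ σ′ ∣ ≡ suc d
  ∣σ∪σ′∣≡1+d =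
    trans (∣p∣≡1+∣p-x∣ (x∈p∪q⁺ (inj₁ a∈σ))) (cong suc (trans (cong ∣_∣ (sym σ′≡σ∪σ′-a)) ∣σ′∣≡d))

differences : ∀ {n d} → (Fin d → Fin n) → (Fin d → Fin n) → List (Fin d)
differences {d = d} f g = filter (λ r → ¬? (f r ≟ g r)) (allFin d)

differences≡[r] : ∀ {n d} {f g : Fin d → Fin n} {r} → DifferOnlyAt f g r → differences f g ≡ [ r ]
differences≡[r] {d = d} {f} {g} {r} (fr≢gr , agree) =
  filter≡[x] (λ r′ → ¬? (f r′ ≟ g r′)) (allFin⁺ d) (∈-allFin r) fr≢gr only
  where
  only : ∀ {r′} → r′ ∈ allFin d → f r′ ≢ g r′ → r′ ≡ r
  only {r′} _ fr′≢gr′ with r′ ≟ r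
  ... | yes r′≡r = r′≡r
  ... | no  r′≢r = contradiction (agree r′ r′≢r) fr′≢gr′

differences≡[r]⁻ : ∀ {n d} {f g : Fin d → Fin n} {r} → differences f g ≡ [ r ] → DifferOnlyAt f g r
differences≡[r]⁻ {d = d} {f} {g} {r} eq = fr≢gr , agree
  where
  facts : r ∈ allFin d × f r ≢ g r × (∀ {r′} → r′ ∈ allFin d → f r′ ≢ g r′ → r′ ≡ r)
  facts = filter≡[x]⁻ (λ r′ → ¬? (f r′ ≟ g r′)) eq
  fr≢gr : f r ≢ g r
  fr≢gr = proj₁ (proj₂ facts)
  agree : ∀ r′ → r′ ≢ r → f r′ ≡ g r′
  agree r′ r′≢r with f r′ ≟ g r′
  ... | yes fr′≡gr′ = fr′≡gr′
  ... | no  fr′≢gr′ = contradiction (proj₂ (proj₂ facts) (∈-allFin r′) fr′≢gr′) r′≢r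

flip-adjacent⇒differ : ∀ {n d} (M : MatchingField n d) {σ σ′} → FlipAdjacent M (σ , σ′) →
  ∃ λ r → differences (match M σ) (match M σ′) ≡ [ r ]
flip-adjacent⇒differ M {σ} {σ′} = length≡1⇒singleton (differences (match M σ) (match M σ′))

module Counting {n d : ℕ} (M : MatchingField n d) (linkage : IsLinkage M) where

  Pairs : List (Subset n × Subset n)
  Pairs = pairsOf (dSubsets n d)

  Key : Set
  Key = Subset n × List (Fin d)

  key : Subset n × Subset n → Key
  key (σ , σ′) = σ ∪ σ′ , differences (match M σ) (match M σ′)

  Keys : List Key
  Keys = cartesianProduct (dSubsets n (suc d)) (map [_] (allFin d))

  _≟ₖ_ : DecidableEquality Key
  _≟ₖ_ = ≡-decˣ (≡-decᵛ _≟ᵇ_) (≡-decˡ _≟_)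

  ∈dSubsets⁻ : ∀ {k σ} → σ ∈ dSubsets n k → ∣ σ ∣ ≡ k
  ∈dSubsets⁻ {k} σ∈ = proj₂ (∈-filter⁻ (λ s → ∣ s ∣ ℕ.≟ k) {xs = allSubsets n} σ∈)

  ∈dSubsets⁺ : ∀ {k σ} → ∣ σ ∣ ≡ k → σ ∈ dSubsets n k
  ∈dSubsets⁺ {k} {σ} = ∈-filter⁺ (λ s → ∣ s ∣ ℕ.≟ k) (allSubsets-complete σ)

  key-lands : ∀ {x} → x ∈ Pairs → FlipAdjacent M x → key x ∈ Keys
  key-lands {σ , σ′} x∈ adjacent with flip-adjacent⇒differ M adjacent
  ... | r , diff≡[r] = ∈-cartesianProduct⁺
        (∈dSubsets⁺ (FlipShape.∣σ∪σ′∣≡1+d M (∈dSubsets⁻ σ∈) (∈dSubsets⁻ σ′∈)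
                                           (differences≡[r]⁻ diff≡[r])))
        (subst (_∈ map [_] (allFin d)) (sym diff≡[r]) (∈-map⁺ [_] (∈-allFin r)))
    where
    σ∈ : σ ∈ dSubsets n d
    σ∈ = proj₁ (∈-pairsOf⁻ (dSubsets n d) x∈)
    σ′∈ : σ′ ∈ dSubsets n d
    σ′∈ = proj₂ (∈-pairsOf⁻ (dSubsets n d) x∈)

  module Fibre (τ : Subset n) (∣τ∣≡1+d : ∣ τ ∣ ≡ suc d) (r : Fin d) where
    open WithinTree M linkage τ ∣τ∣≡1+d

    OverKey : Subset n × Subset n → Set
    OverKey x = FlipAdjacent M x × key x ≡ (τ , [ r ])

    over-key : ∀ {x y} → FlipPair r x y → OverKey (τ - x , τ - y)
    over-key (x∈τ , y∈τ , x≢y , diff) =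
      cong length (differences≡[r] diff) , cong₂ _,_ (p-x∪p-y≡p x∈τ y∈τ x≢y) (differences≡[r] diff)

    from-flip-pair : ∀ {x} → x ∈ Pairs → OverKey x → ∃₂ λ b a → FlipPair r b a × x ≡ (τ - b , τ - a)
    from-flip-pair {σ , σ′} x∈ (_ , key≡) =
      b , a , (b∈τ , a∈τ , b≢a , subst₂ (λ s s′ → DifferOnlyAt (match M s) (match M s′) r) σ≡τ-b σ′≡τ-a diff)
        , cong₂ _,_ σ≡τ-b σ′≡τ-a
      where
      ∣σ∣≡d : ∣ σ ∣ ≡ d
      ∣σ∣≡d = ∈dSubsets⁻ (proj₁ (∈-pairsOf⁻ (dSubsets n d) x∈))
      ∣σ′∣≡d : ∣ σ′ ∣ ≡ d
      ∣σ′∣≡d = ∈dSubsets⁻ (proj₂ (∈-pairsOf⁻ (dSubsets n d) x∈))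
      σ∪σ′≡τ : σ ∪ σ′ ≡ τ
      σ∪σ′≡τ = cong proj₁ key≡
      diff : DifferOnlyAt (match M σ) (match M σ′) r
      diff = differences≡[r]⁻ (cong proj₂ key≡)
      module S = FlipShape M ∣σ∣≡d ∣σ′∣≡d diff
      module S′ = FlipShape M ∣σ′∣≡d ∣σ∣≡d (DifferOnlyAt-sym diff)
      a : Fin n
      a = S.a
      b : Fin n
      b = S′.a
      σ′≡τ-a : σ′ ≡ τ - a
      σ′≡τ-a = trans S.σ′≡σ∪σ′-a (cong (_- a) σ∪σ′≡τ)
      σ≡τ-b : σ ≡ τ - b
      σ≡τ-b = trans S′.σ′≡σ∪σ′-a (cong (_- b) (trans (∪-comm σ′ σ) σ∪σ′≡τ))
      a∈τ : a ∈ₛ τ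
      a∈τ = subst (a ∈ₛ_) σ∪σ′≡τ (x∈p∪q⁺ (inj₁ S.a∈σ))
      b∈τ : b ∈ₛ τ
      b∈τ = subst (b ∈ₛ_) σ∪σ′≡τ (x∈p∪q⁺ (inj₂ S′.a∈σ))
      b≢a : b ≢ a
      b≢a b≡a = S.a∉σ′ (subst (_∈ₛ σ′) b≡a S′.a∈σ)

    -- Exactly one flip edge lies over the key: existence from flip-pair,
    -- uniqueness from flip-pair-unique (pairsOf lists each pair in one order).
    fibre : length (filter (λ x → flipAdjacent? M x ×-dec (key x ≟ₖ (τ , [ r ]))) Pairs) ≡ 1
    fibre with flip-pair r
    ... | x , y , pair = cong length (filter≡[x] _ (pairsOf-unique D-unique) (proj₁ (proj₂ edge)) (proj₂ (proj₂ edge)) only)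
      where
      D-unique : Unique (dSubsets n d)
      D-unique = unique-filter _ (allSubsets-unique n)
      τ-z∈ : ∀ {z} → z ∈ₛ τ → τ - z ∈ dSubsets n d
      τ-z∈ z∈τ = ∈dSubsets⁺ (∣τ-z∣≡d z∈τ)
      τ-x≢τ-y : τ - x ≢ τ - y
      τ-x≢τ-y eq = x∈p-y⇒x≢y (subst (x ∈ₛ_) (sym eq) (x∈p∧x≢y⇒x∈p-y x∈τ x≢y)) refl
        where
        x∈τ : x ∈ₛ τ
        x∈τ = proj₁ pair
        x≢y : x ≢ y
        x≢y = proj₁ (proj₂ (proj₂ pair))
      edge : ∃ λ e → e ∈ Pairs × OverKey e
      edge with ∈-pairsOf⁺ (τ-z∈ (proj₁ pair)) (τ-z∈ (proj₁ (proj₂ pair))) τ-x≢τ-y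
      ... | inj₁ e∈ = _ , e∈ , over-key pair
      ... | inj₂ e∈ = _ , e∈ , over-key (FlipPair-sym pair)
      only : ∀ {z} → z ∈ Pairs → OverKey z → z ≡ proj₁ edge
      only z∈ z-over with from-flip-pair z∈ z-over | from-flip-pair (proj₁ (proj₂ edge)) (proj₂ (proj₂ edge))
      ... | b , a , ba , z≡ | b′ , a′ , b′a′ , e≡ with flip-pair-unique ba b′a′
      ...   | inj₁ (refl , refl) = trans z≡ (sym e≡)
      ...   | inj₂ (refl , refl) = contradiction
              (subst (_∈ Pairs) e≡ (proj₁ (proj₂ edge))) (pairsOf-asymmetric D-unique (subst (_∈ Pairs) z≡ z∈))

  Keys-unique : Unique Keys
  Keys-unique = cartesianProduct⁺ (unique-filter _ (allSubsets-unique n)) (unique-map ∷-injectiveˡ (allFin⁺ d))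

  length-Keys : length Keys ≡ (n C suc d) * d
  length-Keys = begin
    length Keys
      ≡⟨ length-cartesianProduct (dSubsets n (suc d)) _ ⟩
    length (dSubsets n (suc d)) * length (map [_] (allFin d))
      ≡⟨ cong₂ _*_ (length-dSubsets n (suc d)) (length-map [_] (allFin d)) ⟩
    (n C suc d) * length (allFin d)
      ≡⟨ cong ((n C suc d) *_) (length-tabulate (λ i → i)) ⟩
    (n C suc d) * d ∎
    where open ≡-Reasoning

  fibres : ∀ {k} → k ∈ Keys → length (filter (λ x → flipAdjacent? M x ×-dec (key x ≟ₖ k)) Pairs) ≡ 1
  fibres {τ , _} k∈ with ∈-cartesianProduct⁻ (dSubsets n (suc d)) (map [_] (allFin d)) k∈
  ... | τ∈ , r∈ with ∈-map⁻ [_] r∈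
  ...   | r , _ , refl = Fibre.fibre τ (∈dSubsets⁻ τ∈) r

-- The theorem: double counting with one flip edge per key.
lemma3p38 : (n d : ℕ) → d ≤ n → (M : MatchingField n d) → IsLinkage M →
    numFlipEdges M ≡ (n C suc d) * d
lemma3p38 n d _ M linkage = begin
  numFlipEdges M
    ≡⟨ fibre-count _≟ₖ_ key (flipAdjacent? M) Pairs Keys 1 Keys-unique key-lands fibres ⟩
  length Keys * 1
    ≡⟨ *-identityʳ (length Keys) ⟩
  length Keys
    ≡⟨ length-Keys ⟩
  (n C suc d) * d ∎
  where
  open ≡-Reasoning
  open Counting M linkage
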